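{- Let $\mathbf c,\mathbf c'$ be linear orders on $c_1,\dots,c_t$ whose canonical sequences are respectively $(r_1,\dots,r_t)$ and $(r_1,\dots,r_{i-1},r_{i+1},r_i+1,r_{i+2},\dots,r_t)$ for some $i$ with $r_i>r_{i+1}$. Then for every label $k$, the graphs $\mathscr G(\mathbf c)$ and $\mathscr G(\mathbf c')$ have the same number of vertices with label $k$ and the same number of edges with label $k$.
   Context: Let $T=\{1,\dots,t\}$. A linear order $\mathbf c$ on symbols $c_1,\dots,c_t$ determines a labelled graph $\mathscr G(\mathbf c)$ (vertices labelled in $\{1,\dots,t+1\}$, edges labelled in $T$), defined inductively. For $t=1$: two vertices labelled $1$ and $2$ joined by an edge labelled $1$. For $t\ge2$: let $c_s$ be the maximal element of $\mathbf c$. Let $\mathbf c'$ be the induced order on $\mathbf c\setminus\{c_s\}$, reindexed by keeping indices $<s$ and decreasing indices $>s$ by $1$; let $\mathscr G'=\mathscr G(\mathbf c')$. Let $\mathscr G^+$ be a copy of $\mathscr G'$ in which every label (on vertices and edges) $\ell\le s-1$ is kept and every label $\ell\ge s$ is replaced by $\ell+1$. Let $\mathscr G^-$ be a second copy of the same underlying graph, with $\varphi:\mathscr G^+\to\mathscr G^-$ the identification, carrying the same labels except that vertices labelled $s+1$ in $\mathscr G^+$ are labelled $s$ in $\mathscr G^-$. Then $\mathscr G(\mathbf c)$ is the disjoint union of $\mathscr G^+$ and $\mathscr G^-$ together with, for each vertex $v$ of $\mathscr G^+$ of label $s+1$, an edge labelled $s$ joining $v$ and $\varphi(v)$. Canonical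 sequence of $\mathbf c$: let $(k_1,\dots,k_t)$ be the permutation of $T$ with $c_{k_1}<c_{k_2}<\dots<c_{k_t}$, and set $n(k_i)=k_i-|\{j>i: k_j<k_i\}|$; the canonical sequence is $(n(k_1),\dots,n(k_t))$ (it satisfies $1\le n(k_i)\le i$). -}

module Defs where

open import Data.Nat using (ℕ; zero; suc; _+_; _∸_; _<ᵇ_; _≡ᵇ_)
open import Data.Bool using (Bool; true; false; if_then_else_)
open import Data.List using (List; []; _∷_; _++_; map; length; reverse; upTo; zip; foldr)
open import Data.Product using (_×_; _,_)

-- A linear order c on symbols c_1,…,c_t is represented by the list
-- (k_1,…,k_t) with c_{k_1} < c_{k_2} < … < c_{k_t}; this list is a
-- permutation of (1,…,t).  (Linear orders on a t-element set are in
-- bijection with such lists.)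

countᵇ : {A : Set} → (A → Bool) → List A → ℕ
countᵇ p []       = 0
countᵇ p (x ∷ xs) = if p x then suc (countᵇ p xs) else countᵇ p xs

canonical : List ℕ → List ℕ
canonical []       = []
canonical (k ∷ ks) = (k ∸ countᵇ (λ j → j <ᵇ k) ks) ∷ canonical ks

-- A finite labelled multigraph: vertices are 0,…,n-1 where n is the
-- length of vlabels (vlabels lists the label of each vertex); each edge
-- is a triple (u , v , label) of endpoints and label.
record Graph : Set where
  constructor graph
  field
    vlabels : List ℕ
    edges   : List (ℕ × ℕ × ℕ)
open Graph public

#vertices : ℕ → Graph → ℕ
#vertices k g = countᵇ (λ ℓ → ℓ ≡ᵇ k) (vlabels g)

#edges : ℕ → Graph → ℕ
#edges k g = countᵇ (λ { (_ , _ , ℓ) → ℓ ≡ᵇ k }) (edges g)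

relab : ℕ → ℕ → ℕ
relab s ℓ = if ℓ <ᵇ s then ℓ else suc ℓ

relab⁻ : ℕ → ℕ → ℕ
relab⁻ s ℓ = if ℓ ≡ᵇ suc s then s else ℓ

extraEdges : ℕ → ℕ → List (ℕ × ℕ) → List (ℕ × ℕ × ℕ)
extraEdges s n = foldr (λ { (v , ℓ) acc → if ℓ ≡ᵇ suc s then (v , n + v , s) ∷ acc else acc }) []

-- inductive step: from G' = G(c') and s (index of the maximal element) build G(c)
step : ℕ → Graph → Graph
step s (graph vl es) = graph (vl⁺ ++ vl⁻) (es⁺ ++ es⁻ ++ extraEdges s n (zip (upTo n) vl⁺))
  where
    n   = length vl
    vl⁺ = map (relab s) vl
    es⁺ = map (λ { (u , v , ℓ) → (u , v , relab s ℓ) }) es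
    vl⁻ = map (relab⁻ s) vl⁺
    es⁻ = map (λ { (u , v , ℓ) → (n + u , n + v , ℓ) }) es⁺

reidx : ℕ → ℕ → ℕ
reidx s k = if k <ᵇ s then k else k ∸ 1

base : Graph
base = graph (1 ∷ 2 ∷ []) ((0 , 1 , 1) ∷ [])

empty : Graph
empty = graph [] []

-- argument: the order listed from the maximum down (reverse of (k_1,…,k_t)),
-- with a fuel parameter equal to its length
𝒢-aux : ℕ → List ℕ → Graph
𝒢-aux zero    _              = empty
𝒢-aux (suc f) []             = empty
𝒢-aux (suc f) (s ∷ [])       = base
𝒢-aux (suc f) (s ∷ r ∷ rest) = step s (𝒢-aux f (map (reidx s) (r ∷ rest)))

𝒢 : List ℕ → Graph
𝒢 ks = 𝒢-aux (length ks) (reverse ks)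

oneTo : ℕ → List ℕ
oneTo t = map suc (upTo t)

module Submission where

-- The numbers of vertices and edges of 'step s g' whose label
--    passes an arbitrary Boolean test are determined by those of g
--    (vertexCount-step, edgeCount-step).  So "same statistics" (_≈_) is a
--    congruence for 'step', and for b < a the key commutation
--    step b ∘ step a ≈ step (a+1) ∘ step b  holds (commute).
--  * Canonical recursion.  Deleting the maximal element c_s of c and
--    reindexing leaves the other canonical entries unchanged (canonical-snoc),
--    so 𝒢(c) = build (r_t, …, r_1): the steps r_t, …, r_2 applied to the base
--    graph (𝒢-build).  The exchange is then an instance of the commutation.
--  * Bounds.  The entries satisfy 1 ≤ r_i ≤ i (revCanonical-subdiagonal); in
--    particular (r_1, r_2) is never a descent, so a step lies below the
--    exchanged pair, as the commutation requires.

open import Defs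
open import Data.Bool using (Bool; true; false; if_then_else_)
open import Data.Nat using (ℕ; zero; suc; pred; _+_; _*_; _∸_; _<ᵇ_; _≡ᵇ_; _≤_; _<_; z≤n; s≤s)
open import Data.Nat.Properties
  using (≤-refl; ≤-trans; <-trans; <⇒≤; m≤n⇒m≤1+n; <⇒≤pred; ≤-pred; pred-mono-≤; <-cmp;
         <-asym; <-irrefl; 1+n≰n; 0≢1+n; suc-injective; *-zeroʳ; +-assoc; +-commutativeSemigroup; +-identityʳ; +-comm; ∸-+-assoc)
open import Data.Nat.Tactic.RingSolver using (solve-∀)
open import Algebra.Properties.CommutativeSemigroup +-commutativeSemigroup
  using () renaming (interchange to +-interchange)
open import Data.List using (List; []; _∷_; _++_; map; length; reverse; upTo; zip)
open import Data.List.Properties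
  using (length-map; length-upTo; length-reverse; reverse-++; unfold-reverse; reverse-map;
         reverse-involutive; ++-assoc)
open import Data.List.Relation.Unary.All as All using (All; []; _∷_)
import Data.List.Relation.Unary.All.Properties as AllP
open import Data.List.Relation.Unary.AllPairs as AllPairs using ([]; _∷_)
open import Data.List.Relation.Unary.Unique.Propositional using (Unique)
import Data.List.Relation.Unary.Unique.Propositional.Properties as UniqueP
open import Data.List.Relation.Binary.Permutation.Propositional using (_↭_; ↭-sym; ↭-trans; ↭⇒↭ₛ)
open import Data.List.Relation.Binary.Permutation.Propositional.Properties
  using (All-resp-↭; ↭-reverse; ↭-length)
open import Data.List.Relation.Binary.Permutation.Setoid.Properties using (Unique-resp-↭)
open import Data.Product using (_×_; _,_; proj₁; proj₂)
open import Data.Empty using (⊥-elim)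
open import Function using (_∘_)
open import Relation.Binary using (tri<; tri≈; tri>)
open import Relation.Binary.PropositionalEquality
  using (_≡_; _≢_; refl; sym; trans; cong; cong₂; subst; subst₂; setoid; module ≡-Reasoning)
open import Relation.Nullary using (¬_)

open ≡-Reasoning

countᵇ-++ : {A : Set} (p : A → Bool) (xs ys : List A) →
  countᵇ p (xs ++ ys) ≡ countᵇ p xs + countᵇ p ys
countᵇ-++ p []       ys = refl
countᵇ-++ p (x ∷ xs) ys with p x
... | true  = cong suc (countᵇ-++ p xs ys)
... | false = countᵇ-++ p xs ys

countᵇ-map : {A B : Set} (p : B → Bool) (f : A → B) (xs : List A) →
  countᵇ p (map f xs) ≡ countᵇ (p ∘ f) xs
countᵇ-map p f []       = refl
countᵇ-map p f (x ∷ xs) rewrite countᵇ-map p f xs = refl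

countᵇ-cong : {A : Set} {p q : A → Bool} {xs : List A} →
  All (λ x → p x ≡ q x) xs → countᵇ p xs ≡ countᵇ q xs
countᵇ-cong []                     = refl
countᵇ-cong {xs = x ∷ xs} (e ∷ es) rewrite e | countᵇ-cong es = refl

countᵇ-ext : {A : Set} {p q : A → Bool} → (∀ x → p x ≡ q x) → (xs : List A) →
  countᵇ p xs ≡ countᵇ q xs
countᵇ-ext e xs = countᵇ-cong (All.universal e xs)

𝟙 : Bool → ℕ
𝟙 b = if b then 1 else 0

relab-suc : ∀ s ℓ → relab (suc s) (suc ℓ) ≡ suc (relab s ℓ)
relab-suc s ℓ with ℓ <ᵇ s
... | true  = refl
... | false = refl

relab⁻-suc : ∀ s ℓ → relab⁻ (suc s) (suc ℓ) ≡ suc (relab⁻ s ℓ)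
relab⁻-suc s ℓ with ℓ ≡ᵇ suc s
... | true  = refl
... | false = refl

relab-below : ∀ s ℓ → ℓ < s → relab s ℓ ≡ ℓ
relab-below (suc s) zero    _       = refl
relab-below (suc s) (suc ℓ) (s≤s p) rewrite relab-suc s ℓ = cong suc (relab-below s ℓ p)

relab-above : ∀ s ℓ → s ≤ ℓ → relab s ℓ ≡ suc ℓ
relab-above zero    ℓ       _       = refl
relab-above (suc s) (suc ℓ) (s≤s p) rewrite relab-suc s ℓ = cong suc (relab-above s ℓ p)

relab-comm : ∀ b a ℓ → b ≤ a → relab b (relab a ℓ) ≡ relab (suc a) (relab b ℓ)
relab-comm zero    a       ℓ       _ = sym (relab-suc a ℓ)
relab-comm (suc b) (suc a) zero    _ = refl
relab-comm (suc b) (suc a) (suc ℓ) (s≤s p)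
  rewrite relab-suc a ℓ | relab-suc b (relab a ℓ) | relab-suc b ℓ
        | relab-suc (suc a) (relab b ℓ) | relab-comm b a ℓ p = refl

-- The labels of G⁻ are those of G' shifted at s+1 instead of s.
relab⁻∘relab : ∀ s ℓ → relab⁻ s (relab s ℓ) ≡ relab (suc s) ℓ
relab⁻∘relab zero    zero    = refl
relab⁻∘relab zero    (suc ℓ) = refl
relab⁻∘relab (suc s) zero    = refl
relab⁻∘relab (suc s) (suc ℓ)
  rewrite relab-suc s ℓ | relab⁻-suc s (relab s ℓ) | relab-suc (suc s) ℓ | relab⁻∘relab s ℓ = refl

relab-hits-below : ∀ j s x → j < s → (relab s x ≡ᵇ j) ≡ (x ≡ᵇ j)
relab-hits-below zero    (suc s) zero    _       = refl
relab-hits-below zero    (suc s) (suc x) _       rewrite relab-suc s x = refl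
relab-hits-below (suc j) (suc s) zero    _       = refl
relab-hits-below (suc j) (suc s) (suc x) (s≤s p) rewrite relab-suc s x = relab-hits-below j s x p

relab-hits-above : ∀ s j x → s ≤ j → (relab s x ≡ᵇ suc j) ≡ (x ≡ᵇ j)
relab-hits-above zero    j       x       _       = refl
relab-hits-above (suc s) (suc j) zero    _       = refl
relab-hits-above (suc s) (suc j) (suc x) (s≤s p) rewrite relab-suc s x = relab-hits-above s j x p

-- Label statistics of a graph: the numbers of vertices and of edges whose
-- label passes a test q.  Arbitrary tests are needed because 'step' relabels.

label : ℕ × ℕ × ℕ → ℕ
label e = proj₂ (proj₂ e)

vertexCount : (ℕ → Bool) → Graph → ℕ
vertexCount q g = countᵇ q (vlabels g)

edgeCount : (ℕ → Bool) → Graph → ℕ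
edgeCount q g = countᵇ (q ∘ label) (edges g)

vertexCount-step : ∀ s g q →
  vertexCount q (step s g) ≡ vertexCount (q ∘ relab s) g + vertexCount (q ∘ relab (suc s)) g
vertexCount-step s (graph vl es) q = begin
  countᵇ q (vl⁺ ++ map (relab⁻ s) vl⁺)
    ≡⟨ countᵇ-++ q vl⁺ (map (relab⁻ s) vl⁺) ⟩
  countᵇ q vl⁺ + countᵇ q (map (relab⁻ s) vl⁺)
    ≡⟨ cong₂ _+_ (countᵇ-map q (relab s) vl)
                 (trans (countᵇ-map q (relab⁻ s) vl⁺)
                 (trans (countᵇ-map (q ∘ relab⁻ s) (relab s) vl)
                        (countᵇ-ext (cong q ∘ relab⁻∘relab s) vl))) ⟩
  countᵇ (q ∘ relab s) vl + countᵇ (q ∘ relab (suc s)) vl ∎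
  where
  vl⁺ : List ℕ
  vl⁺ = map (relab s) vl

-- All connecting edges carry label s, one per entry of label s+1.
extraEdges-count : ∀ s n ps q →
  countᵇ (q ∘ label) (extraEdges s n ps) ≡ 𝟙 (q s) * countᵇ ((_≡ᵇ suc s) ∘ proj₂) ps
extraEdges-count s n []             q = sym (*-zeroʳ (𝟙 (q s)))
extraEdges-count s n ((v , ℓ) ∷ ps) q with ℓ ≡ᵇ suc s
... | false = extraEdges-count s n ps q
... | true rewrite extraEdges-count s n ps q = one-more (q s) (countᵇ ((_≡ᵇ suc s) ∘ proj₂) ps)
  where
  one-more : ∀ b m → (if b then suc (𝟙 b * m) else 𝟙 b * m) ≡ 𝟙 b * suc m
  one-more true  m = refl
  one-more false m = refl

countᵇ-zip : ∀ (r : ℕ → Bool) (xs ys : List ℕ) → length ys ≤ length xs →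
  countᵇ (r ∘ proj₂) (zip xs ys) ≡ countᵇ r ys
countᵇ-zip r []       []       _       = refl
countᵇ-zip r (x ∷ xs) []       _       = refl
countᵇ-zip r (x ∷ xs) (y ∷ ys) (s≤s l) with r y
... | true  = cong suc (countᵇ-zip r xs ys l)
... | false = countᵇ-zip r xs ys l

-- G⁺ and G⁻ both carry the edge labels of G' shifted at s; in addition there
-- is one edge labelled s for every vertex of G' labelled s.
edgeCount-step : ∀ s g q →
  edgeCount q (step s g) ≡
  (edgeCount (q ∘ relab s) g + edgeCount (q ∘ relab s) g) + 𝟙 (q s) * vertexCount (_≡ᵇ s) g
edgeCount-step s (graph vl es) q = begin
  countᵇ Q (es⁺ ++ es⁻ ++ extra)
    ≡⟨ countᵇ-++ Q es⁺ (es⁻ ++ extra) ⟩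
  countᵇ Q es⁺ + countᵇ Q (es⁻ ++ extra)
    ≡⟨ cong (countᵇ Q es⁺ +_) (countᵇ-++ Q es⁻ extra) ⟩
  countᵇ Q es⁺ + (countᵇ Q es⁻ + countᵇ Q extra)
    ≡⟨ cong₂ (λ x y → x + (y + countᵇ Q extra)) shifted (trans (countᵇ-map Q _ es⁺) shifted) ⟩
  E + (E + countᵇ Q extra)
    ≡⟨ cong (λ z → E + (E + z)) (trans (extraEdges-count s n ps q) (cong (𝟙 (q s) *_) connected)) ⟩
  E + (E + 𝟙 (q s) * countᵇ (_≡ᵇ s) vl)
    ≡⟨ sym (+-assoc E E _) ⟩
  (E + E) + 𝟙 (q s) * countᵇ (_≡ᵇ s) vl ∎
  where
  Q : ℕ × ℕ × ℕ → Bool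
  Q = q ∘ label
  n : ℕ
  n = length vl
  vl⁺ : List ℕ
  vl⁺ = map (relab s) vl
  es⁺ es⁻ : List (ℕ × ℕ × ℕ)
  es⁺ = map (λ { (u , v , ℓ) → (u , v , relab s ℓ) }) es
  es⁻ = map (λ { (u , v , ℓ) → (n + u , n + v , ℓ) }) es⁺
  ps : List (ℕ × ℕ)
  ps = zip (upTo n) vl⁺
  extra : List (ℕ × ℕ × ℕ)
  extra = extraEdges s n ps
  E : ℕ
  E = countᵇ (q ∘ relab s ∘ label) es
  shifted : countᵇ Q es⁺ ≡ E
  shifted = countᵇ-map Q _ es
  connected : countᵇ ((_≡ᵇ suc s) ∘ proj₂) ps ≡ countᵇ (_≡ᵇ s) vl
  connected = begin
    countᵇ ((_≡ᵇ suc s) ∘ proj₂) ps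
      ≡⟨ countᵇ-zip (_≡ᵇ suc s) (upTo n) vl⁺
           (subst₂ _≤_ (sym (length-map (relab s) vl)) (sym (length-upTo n)) ≤-refl) ⟩
    countᵇ (_≡ᵇ suc s) vl⁺
      ≡⟨ countᵇ-map _ (relab s) vl ⟩
    countᵇ (λ ℓ → relab s ℓ ≡ᵇ suc s) vl
      ≡⟨ countᵇ-ext (λ ℓ → relab-hits-above s s ℓ ≤-refl) vl ⟩
    countᵇ (_≡ᵇ s) vl ∎

record _≈_ (g h : Graph) : Set where
  field
    sameVertices : ∀ q → vertexCount q g ≡ vertexCount q h
    sameEdges    : ∀ q → edgeCount q g ≡ edgeCount q h
open _≈_

step-≈ : ∀ s {g h} → g ≈ h → step s g ≈ step s h
step-≈ s {g} {h} g≈h = record { sameVertices = vertices ; sameEdges = edges′ }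
  where
  vertices : ∀ q → vertexCount q (step s g) ≡ vertexCount q (step s h)
  vertices q = begin
    vertexCount q (step s g)
      ≡⟨ vertexCount-step s g q ⟩
    vertexCount (q ∘ relab s) g + vertexCount (q ∘ relab (suc s)) g
      ≡⟨ cong₂ _+_ (sameVertices g≈h (q ∘ relab s)) (sameVertices g≈h (q ∘ relab (suc s))) ⟩
    vertexCount (q ∘ relab s) h + vertexCount (q ∘ relab (suc s)) h
      ≡⟨ sym (vertexCount-step s h q) ⟩
    vertexCount q (step s h) ∎
  edges′ : ∀ q → edgeCount q (step s g) ≡ edgeCount q (step s h)
  edges′ q = begin
    edgeCount q (step s g)
      ≡⟨ edgeCount-step s g q ⟩
    (edgeCount (q ∘ relab s) g + edgeCount (q ∘ relab s) g) + 𝟙 (q s) * vertexCount (_≡ᵇ s) g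
      ≡⟨ cong₂ (λ e v → (e + e) + 𝟙 (q s) * v) (sameEdges g≈h (q ∘ relab s)) (sameVertices g≈h (_≡ᵇ s)) ⟩
    (edgeCount (q ∘ relab s) h + edgeCount (q ∘ relab s) h) + 𝟙 (q s) * vertexCount (_≡ᵇ s) h
      ≡⟨ sym (edgeCount-step s h q) ⟩
    edgeCount q (step s h) ∎

-- Vertex part of the commutation: the four relabellings of G' match up in pairs.
commute-vertices : ∀ {b a} g q → b < a →
  vertexCount q (step b (step a g)) ≡ vertexCount q (step (suc a) (step b g))
commute-vertices {b} {a} g q b<a = begin
  vertexCount q (step b (step a g))
    ≡⟨ twice b a ⟩
  (V (q ∘ relab b ∘ relab a) + V (q ∘ relab b ∘ relab (suc a)))
    + (V (q ∘ relab (suc b) ∘ relab a) + V (q ∘ relab (suc b) ∘ relab (suc a)))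
    ≡⟨ cong₂ _+_ (cong₂ _+_ (exchange b≤a) (exchange (m≤n⇒m≤1+n b≤a)))
                 (cong₂ _+_ (exchange b<a) (exchange (s≤s b≤a))) ⟩
  (V₁ + V₂) + (V₃ + V₄)
    ≡⟨ +-interchange V₁ V₂ V₃ V₄ ⟩
  (V₁ + V₃) + (V₂ + V₄)
    ≡⟨ sym (twice (suc a) b) ⟩
  vertexCount q (step (suc a) (step b g)) ∎
  where
  b≤a : b ≤ a
  b≤a = <⇒≤ b<a
  V : (ℕ → Bool) → ℕ
  V p = vertexCount p g
  V₁ V₂ V₃ V₄ : ℕ
  V₁ = V (q ∘ relab (suc a) ∘ relab b)
  V₂ = V (q ∘ relab (suc (suc a)) ∘ relab b)
  V₃ = V (q ∘ relab (suc a) ∘ relab (suc b))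
  V₄ = V (q ∘ relab (suc (suc a)) ∘ relab (suc b))
  twice : ∀ x y → vertexCount q (step x (step y g)) ≡
    (V (q ∘ relab x ∘ relab y) + V (q ∘ relab x ∘ relab (suc y)))
      + (V (q ∘ relab (suc x) ∘ relab y) + V (q ∘ relab (suc x) ∘ relab (suc y)))
  twice x y = trans (vertexCount-step x (step y g) q)
                    (cong₂ _+_ (vertexCount-step y g _) (vertexCount-step y g _))
  exchange : ∀ {x y} → x ≤ y → V (q ∘ relab x ∘ relab y) ≡ V (q ∘ relab (suc y) ∘ relab x)
  exchange {x} {y} x≤y = countᵇ-ext (λ ℓ → cong q (relab-comm x y ℓ x≤y)) (vlabels g)

-- The edge counts of both orders of the two steps, as polynomials in the
-- statistics of G'; they agree by commutativity of addition.
edge-balance : ∀ X A B α β →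
  ((X + X + α * A) + (X + X + α * A)) + β * (B + B) ≡ ((X + X + β * B) + (X + X + β * B)) + α * (A + A)
edge-balance = solve-∀

-- Edge part of the commutation.  With X the edges of G' relabelled by both
-- shifts, A and B the vertices of G' labelled a and b, both sides equal
-- 4X + 2·[q b]·B + 2·[q (a+1)]·A.
commute-edges : ∀ {b a} g q → b < a →
  edgeCount q (step b (step a g)) ≡ edgeCount q (step (suc a) (step b g))
commute-edges {b} {a} g q b<a = begin
  edgeCount q (step b (step a g))
    ≡⟨ edgeCount-step b (step a g) q ⟩
  (edgeCount (q ∘ relab b) (step a g) + edgeCount (q ∘ relab b) (step a g))
    + 𝟙 (q b) * vertexCount (_≡ᵇ b) (step a g)
    ≡⟨ cong₂ (λ e v → (e + e) + 𝟙 (q b) * v) inner-a labelled-b ⟩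
  ((X + X + α * A) + (X + X + α * A)) + β * (B + B)
    ≡⟨ edge-balance X A B α β ⟩
  ((X + X + β * B) + (X + X + β * B)) + α * (A + A)
    ≡⟨ sym (cong₂ (λ e v → (e + e) + α * v) inner-b labelled-a) ⟩
  (edgeCount (q ∘ relab (suc a)) (step b g) + edgeCount (q ∘ relab (suc a)) (step b g))
    + α * vertexCount (_≡ᵇ suc a) (step b g)
    ≡⟨ sym (edgeCount-step (suc a) (step b g) q) ⟩
  edgeCount q (step (suc a) (step b g)) ∎
  where
  b≤a : b ≤ a
  b≤a = <⇒≤ b<a
  b<a+1 : b < suc a
  b<a+1 = m≤n⇒m≤1+n b<a
  X A B α β : ℕ
  X = edgeCount (q ∘ relab b ∘ relab a) g
  A = vertexCount (_≡ᵇ a) g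
  B = vertexCount (_≡ᵇ b) g
  α = 𝟙 (q (suc a))
  β = 𝟙 (q b)
  inner-a : edgeCount (q ∘ relab b) (step a g) ≡ X + X + α * A
  inner-a = trans (edgeCount-step a g (q ∘ relab b))
                  (cong (λ ℓ → X + X + 𝟙 (q ℓ) * A) (relab-above b a b≤a))
  inner-b : edgeCount (q ∘ relab (suc a)) (step b g) ≡ X + X + β * B
  inner-b = trans (edgeCount-step b g (q ∘ relab (suc a)))
                  (cong₂ (λ x ℓ → x + x + 𝟙 (q ℓ) * B)
                         (countᵇ-ext (λ e → cong q (sym (relab-comm b a (label e) b≤a))) (edges g))
                         (relab-below (suc a) b b<a+1))
  labelled-b : vertexCount (_≡ᵇ b) (step a g) ≡ B + B
  labelled-b = trans (vertexCount-step a g (_≡ᵇ b))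
                     (cong₂ _+_ (countᵇ-ext (λ ℓ → relab-hits-below b a ℓ b<a) (vlabels g))
                                (countᵇ-ext (λ ℓ → relab-hits-below b (suc a) ℓ b<a+1) (vlabels g)))
  labelled-a : vertexCount (_≡ᵇ suc a) (step b g) ≡ A + A
  labelled-a = trans (vertexCount-step b g (_≡ᵇ suc a))
                     (cong₂ _+_ (countᵇ-ext (λ ℓ → relab-hits-above b a ℓ b≤a) (vlabels g))
                                (countᵇ-ext (λ ℓ → relab-hits-above (suc b) a ℓ b<a) (vlabels g)))

commute : ∀ {b a} g → b < a → step b (step a g) ≈ step (suc a) (step b g)
commute g b<a = record { sameVertices = λ q → commute-vertices g q b<a
                        ; sameEdges    = λ q → commute-edges g q b<a }

-- The graph built from a reversed canonical sequence (r_t, …, r_1): the steps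
-- r_t, …, r_2 applied to the base graph.
buildFrom : ℕ → List ℕ → Graph
buildFrom s []       = base
buildFrom s (r ∷ rs) = step s (buildFrom r rs)

build : List ℕ → Graph
build []       = empty
build (s ∷ ss) = buildFrom s ss

build-cons : ∀ s xs → 0 < length xs → build (s ∷ xs) ≡ step s (build xs)
build-cons s (x ∷ xs) _ = refl

build-≈-prefix : ∀ P {x xs y ys} → build (x ∷ xs) ≈ build (y ∷ ys) →
  build (P ++ x ∷ xs) ≈ build (P ++ y ∷ ys)
build-≈-prefix []           E = E
build-≈-prefix (p ∷ [])     E = step-≈ p E
build-≈-prefix (p ∷ p′ ∷ P) E = step-≈ p (build-≈-prefix (p′ ∷ P) E)

exchange-≈ : ∀ P {a b} x R → b < a →
  build (P ++ b ∷ a ∷ x ∷ R) ≈ build (P ++ suc a ∷ b ∷ x ∷ R)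
exchange-≈ P x R b<a = build-≈-prefix P (commute (buildFrom x R) b<a)

<ᵇ-true : ∀ m n → m < n → (m <ᵇ n) ≡ true
<ᵇ-true zero    (suc n) _       = refl
<ᵇ-true (suc m) (suc n) (s≤s p) = <ᵇ-true m n p

<ᵇ-false : ∀ m n → n ≤ m → (m <ᵇ n) ≡ false
<ᵇ-false m       zero    _       = refl
<ᵇ-false (suc m) (suc n) (s≤s p) = <ᵇ-false m n p

reidx-below : ∀ s k → k < s → reidx s k ≡ k
reidx-below s k k<s rewrite <ᵇ-true k s k<s = refl

reidx-above : ∀ s k → s < k → reidx s k ≡ pred k
reidx-above s k s<k rewrite <ᵇ-false k s (<⇒≤ s<k) = refl

reidx-mono : ∀ s {j k} → j ≢ s → k ≢ s → j < k → reidx s j < reidx s k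
reidx-mono s {j} {k} j≢s k≢s j<k with <-cmp j s | <-cmp k s
... | tri≈ _ j≡s _ | _            = ⊥-elim (j≢s j≡s)
... | _            | tri≈ _ k≡s _ = ⊥-elim (k≢s k≡s)
... | tri< j<s _ _ | tri< k<s _ _ rewrite reidx-below s j j<s | reidx-below s k k<s = j<k
... | tri< j<s _ _ | tri> _ _ s<k rewrite reidx-below s j j<s | reidx-above s k s<k =
  ≤-trans j<s (<⇒≤pred s<k)
... | tri> _ _ s<j | tri< k<s _ _ = ⊥-elim (<-asym j<k (<-trans k<s s<j))
... | tri> _ _ s<j | tri> _ _ s<k rewrite reidx-above s j s<j | reidx-above s k s<k =
  pred-strict s<j j<k
  where
  pred-strict : ∀ {x y z} → x < y → y < z → pred y < pred z
  pred-strict {y = suc y} (s≤s _) (s≤s y<z) = y<z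

reidx-injective : ∀ s {j k} → j ≢ s → k ≢ s → reidx s j ≡ reidx s k → j ≡ k
reidx-injective s {j} {k} j≢s k≢s eq with <-cmp j k
... | tri< j<k _ _ = ⊥-elim (<-irrefl eq (reidx-mono s j≢s k≢s j<k))
... | tri≈ _ j≡k _ = j≡k
... | tri> _ _ k<j = ⊥-elim (<-irrefl (sym eq) (reidx-mono s k≢s j≢s k<j))

reidx-<ᵇ : ∀ s {j k} → j ≢ s → k ≢ s → (reidx s j <ᵇ reidx s k) ≡ (j <ᵇ k)
reidx-<ᵇ s {j} {k} j≢s k≢s with <-cmp j k
... | tri< j<k _ _ = trans (<ᵇ-true _ _ (reidx-mono s j≢s k≢s j<k)) (sym (<ᵇ-true j k j<k))
... | tri≈ _ refl _ = trans (<ᵇ-false (reidx s j) _ ≤-refl) (sym (<ᵇ-false j j ≤-refl))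
... | tri> _ _ k<j = trans (<ᵇ-false _ _ (<⇒≤ (reidx-mono s k≢s j≢s k<j))) (sym (<ᵇ-false j k (<⇒≤ k<j)))

-- The entry n(x) of an element x placed before the deleted index s: the
-- comparison with s accounts exactly for the reindexing of x.
entry-reidx : ∀ s x C → x ≢ s → x ∸ (C + 𝟙 (s <ᵇ x)) ≡ reidx s x ∸ C
entry-reidx s x C x≢s with <-cmp x s
... | tri≈ _ x≡s _ = ⊥-elim (x≢s x≡s)
... | tri< x<s _ _ rewrite <ᵇ-false s x (<⇒≤ x<s) | <ᵇ-true x s x<s | +-identityʳ C = refl
... | tri> _ _ s<x rewrite <ᵇ-true s x s<x | <ᵇ-false x s (<⇒≤ s<x) | +-comm C 1 = sym (∸-+-assoc x 1 C)

canonical-snoc : ∀ s xs → All (s ≢_) xs →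
  canonical (xs ++ s ∷ []) ≡ canonical (map (reidx s) xs) ++ s ∷ []
canonical-snoc s []       _            = refl
canonical-snoc s (x ∷ xs) (s≢x ∷ s≢xs) = cong₂ _∷_ entry (canonical-snoc s xs s≢xs)
  where
  x≢s : x ≢ s
  x≢s = s≢x ∘ sym
  smaller : ℕ → Bool
  smaller = _<ᵇ x
  entry : x ∸ countᵇ smaller (xs ++ s ∷ []) ≡
          reidx s x ∸ countᵇ (_<ᵇ reidx s x) (map (reidx s) xs)
  entry = begin
    x ∸ countᵇ smaller (xs ++ s ∷ [])
      ≡⟨ cong (x ∸_) (countᵇ-++ smaller xs (s ∷ [])) ⟩
    x ∸ (countᵇ smaller xs + 𝟙 (s <ᵇ x))
      ≡⟨ entry-reidx s x (countᵇ smaller xs) x≢s ⟩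
    reidx s x ∸ countᵇ smaller xs
      ≡⟨ cong (reidx s x ∸_) (countᵇ-cong (All.map (λ s≢y → sym (reidx-<ᵇ s (s≢y ∘ sym) x≢s)) s≢xs)) ⟩
    reidx s x ∸ countᵇ ((_<ᵇ reidx s x) ∘ reidx s) xs
      ≡⟨ cong (reidx s x ∸_) (sym (countᵇ-map _ (reidx s) xs)) ⟩
    reidx s x ∸ countᵇ (_<ᵇ reidx s x) (map (reidx s) xs) ∎

revCanonical : List ℕ → List ℕ
revCanonical L = reverse (canonical (reverse L))

length-revCanonical : ∀ L → length (revCanonical L) ≡ length L
length-revCanonical L = trans (length-reverse (canonical (reverse L)))
                              (trans (length-canonical (reverse L)) (length-reverse L))
  where
  length-canonical : ∀ xs → length (canonical xs) ≡ length xs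
  length-canonical []       = refl
  length-canonical (x ∷ xs) = cong suc (length-canonical xs)

-- The recursion behind 𝒢: the maximal element s contributes r_t = s, the rest
-- is the reversed canonical sequence of the reindexed remaining order.
revCanonical-cons : ∀ s rest → All (s ≢_) rest →
  revCanonical (s ∷ rest) ≡ s ∷ revCanonical (map (reidx s) rest)
revCanonical-cons s rest s≢rest = begin
  reverse (canonical (reverse (s ∷ rest)))
    ≡⟨ cong (reverse ∘ canonical) (unfold-reverse s rest) ⟩
  reverse (canonical (reverse rest ++ s ∷ []))
    ≡⟨ cong reverse (canonical-snoc s (reverse rest) (All-resp-↭ (↭-sym (↭-reverse rest)) s≢rest)) ⟩
  reverse (canonical (map (reidx s) (reverse rest)) ++ s ∷ [])
    ≡⟨ reverse-++ (canonical (map (reidx s) (reverse rest))) (s ∷ []) ⟩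
  s ∷ reverse (canonical (map (reidx s) (reverse rest)))
    ≡⟨ cong (λ z → s ∷ reverse (canonical z)) (reverse-map (reidx s) rest) ⟩
  s ∷ revCanonical (map (reidx s) rest) ∎

record Arrangement (n : ℕ) (L : List ℕ) : Set where
  field
    distinct : Unique L
    bounded  : All (λ x → 1 ≤ x × x ≤ n) L
    size     : length L ≡ n
open Arrangement

reverse-arrangement : ∀ t c → c ↭ oneTo t → Arrangement t (reverse c)
reverse-arrangement t c c↭ = record
  { distinct = Unique-resp-↭ (setoid ℕ) (↭⇒↭ₛ σ) (UniqueP.map⁺ suc-injective (UniqueP.upTo⁺ t))
  ; bounded  = All-resp-↭ σ (AllP.map⁺ (All.map (λ x<t → s≤s z≤n , x<t) (AllP.all-upTo t)))
  ; size     = trans (length-reverse c)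
                     (trans (↭-length c↭) (trans (length-map suc (upTo t)) (length-upTo t)))
  }
  where
  σ : oneTo t ↭ reverse c
  σ = ↭-sym (↭-trans (↭-reverse c) c↭)

reidx-arrangement : ∀ {n s rest} → Arrangement (suc n) (s ∷ rest) →
  Arrangement n (map (reidx s) rest)
reidx-arrangement {n} {s} {rest} A = record
  { distinct = reidx-unique rest s≢rest rest-distinct
  ; bounded  = reidx-bounded rest s≢rest rest-bounded
  ; size     = trans (length-map (reidx s) rest) (suc-injective (size A))
  }
  where
  s≢rest : All (s ≢_) rest
  s≢rest = AllPairs.head (distinct A)
  rest-distinct : Unique rest
  rest-distinct = AllPairs.tail (distinct A)
  s-bounds : 1 ≤ s × s ≤ suc n
  s-bounds = All.head (bounded A)
  rest-bounded : All (λ x → 1 ≤ x × x ≤ suc n) rest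
  rest-bounded = All.tail (bounded A)
  reidx-unique : ∀ xs → All (s ≢_) xs → Unique xs → Unique (map (reidx s) xs)
  reidx-unique []       _            _          = []
  reidx-unique (x ∷ xs) (s≢x ∷ s≢xs) (x≢xs ∷ u) =
    AllP.map⁺ (All.zipWith (λ (s≢y , x≢y) → x≢y ∘ reidx-injective s (s≢x ∘ sym) (s≢y ∘ sym)) (s≢xs , x≢xs))
    ∷ reidx-unique xs s≢xs u
  reidx-bounded : ∀ xs → All (s ≢_) xs → All (λ x → 1 ≤ x × x ≤ suc n) xs →
    All (λ x → 1 ≤ x × x ≤ n) (map (reidx s) xs)
  reidx-bounded []       _            _                   = []
  reidx-bounded (x ∷ xs) (s≢x ∷ s≢xs) ((1≤x , x≤n+1) ∷ bs) = bounds ∷ reidx-bounded xs s≢xs bs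
    where
    bounds : 1 ≤ reidx s x × reidx s x ≤ n
    bounds with <-cmp x s
    ... | tri≈ _ x≡s _ = ⊥-elim (s≢x (sym x≡s))
    ... | tri< x<s _ _ rewrite reidx-below s x x<s = 1≤x , ≤-pred (≤-trans x<s (proj₂ s-bounds))
    ... | tri> _ _ s<x rewrite reidx-above s x s<x = ≤-trans (proj₁ s-bounds) (<⇒≤pred s<x) , pred-mono-≤ x≤n+1

𝒢-aux-build : ∀ n L → Arrangement n L → 𝒢-aux n L ≡ build (revCanonical L)
𝒢-aux-build zero    []           _ = refl
𝒢-aux-build (suc n) (s ∷ [])     _ = refl
𝒢-aux-build (suc n) (s ∷ r ∷ rs) A
  rewrite revCanonical-cons s (r ∷ rs) (AllPairs.head (distinct A)) = begin
  step s (𝒢-aux n M)               ≡⟨ cong (step s) (𝒢-aux-build n M A′) ⟩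
  step s (build (revCanonical M))  ≡⟨ sym (build-cons s (revCanonical M) nonempty) ⟩
  build (s ∷ revCanonical M)       ∎
  where
  M : List ℕ
  M = map (reidx s) (r ∷ rs)
  A′ : Arrangement n M
  A′ = reidx-arrangement A
  nonempty : 0 < length (revCanonical M)
  nonempty rewrite length-revCanonical M | length-map (reidx s) (r ∷ rs) = s≤s z≤n
𝒢-aux-build zero    (s ∷ L) A = ⊥-elim (0≢1+n (sym (size A)))
𝒢-aux-build (suc n) []      A = ⊥-elim (0≢1+n (size A))

𝒢-build : ∀ t c → c ↭ oneTo t → 𝒢 c ≡ build (reverse (canonical c))
𝒢-build t c c↭ = begin
  𝒢-aux (length c) (reverse c)           ≡⟨ cong (λ n → 𝒢-aux n (reverse c)) length-c ⟩
  𝒢-aux t (reverse c)                    ≡⟨ 𝒢-aux-build t (reverse c) A ⟩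
  build (revCanonical (reverse c))       ≡⟨ cong (build ∘ reverse ∘ canonical) (reverse-involutive c) ⟩
  build (reverse (canonical c))          ∎
  where
  A : Arrangement t (reverse c)
  A = reverse-arrangement t c c↭
  length-c : length c ≡ t
  length-c = trans (sym (length-reverse c)) (size A)

data Subdiagonal : ℕ → List ℕ → Set where
  []  : Subdiagonal 0 []
  _∷_ : ∀ {n x xs} → 1 ≤ x × x ≤ suc n → Subdiagonal n xs → Subdiagonal (suc n) (x ∷ xs)

revCanonical-subdiagonal : ∀ n L → Arrangement n L → Subdiagonal n (revCanonical L)
revCanonical-subdiagonal zero    []         _ = []
revCanonical-subdiagonal (suc n) (s ∷ rest) A
  rewrite revCanonical-cons s rest (AllPairs.head (distinct A)) =
  All.head (bounded A) ∷ revCanonical-subdiagonal n (map (reidx s) rest) (reidx-arrangement A)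
revCanonical-subdiagonal zero    (s ∷ L) A = ⊥-elim (0≢1+n (sym (size A)))
revCanonical-subdiagonal (suc n) []      A = ⊥-elim (0≢1+n (size A))

-- In a subdiagonal sequence r_1 = 1 ≤ r_2, so (r_1, r_2) is never a descent.
subdiagonal-no-initial-descent : ∀ {n} P {a b} → Subdiagonal n (P ++ b ∷ a ∷ []) → ¬ b < a
subdiagonal-no-initial-descent [] ((1≤b , _) ∷ ((_ , a≤1) ∷ [])) b<a =
  1+n≰n (≤-trans (s≤s 1≤b) (≤-trans b<a a≤1))
subdiagonal-no-initial-descent (p ∷ P) (_ ∷ S) = subdiagonal-no-initial-descent P S

exchange-descent-≈ : ∀ {t c c′} P R {a b} → c ↭ oneTo t → c′ ↭ oneTo t →
  reverse (canonical c) ≡ P ++ b ∷ a ∷ R → reverse (canonical c′) ≡ P ++ suc a ∷ b ∷ R →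
  b < a → 𝒢 c ≈ 𝒢 c′
exchange-descent-≈ {t} {c} P [] c↭ _ eq _ b<a =
  ⊥-elim (subdiagonal-no-initial-descent P subdiagonal b<a)
  where
  subdiagonal : Subdiagonal t (P ++ _ ∷ _ ∷ [])
  subdiagonal = subst (Subdiagonal t)
    (trans (cong (reverse ∘ canonical) (reverse-involutive c)) eq)
    (revCanonical-subdiagonal t (reverse c) (reverse-arrangement t c c↭))
exchange-descent-≈ {t} {c} {c′} P (x ∷ R) c↭ c′↭ eq eq′ b<a =
  subst₂ _≈_ (sym (trans (𝒢-build t c c↭) (cong build eq)))
             (sym (trans (𝒢-build t c′ c′↭) (cong build eq′)))
             (exchange-≈ P x R b<a)

reverse-around-pair : ∀ pre (a b : ℕ) post →
  reverse (pre ++ a ∷ b ∷ post) ≡ reverse post ++ b ∷ a ∷ reverse pre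
reverse-around-pair pre a b post = begin
  reverse (pre ++ (a ∷ b ∷ []) ++ post)         ≡⟨ reverse-++ pre ((a ∷ b ∷ []) ++ post) ⟩
  reverse ((a ∷ b ∷ []) ++ post) ++ reverse pre ≡⟨ cong (_++ reverse pre) (reverse-++ (a ∷ b ∷ []) post) ⟩
  (reverse post ++ b ∷ a ∷ []) ++ reverse pre   ≡⟨ ++-assoc (reverse post) (b ∷ a ∷ []) (reverse pre) ⟩
  reverse post ++ b ∷ a ∷ reverse pre           ∎

-- Lemma 6.5: in reversed form the descent (rᵢ, rᵢ₊₁) becomes an ascent of the
-- reversed canonical sequence, and the label counts are the statistics for _≡ᵇ k.
lemma6p5 : (t : ℕ) (c c′ : List ℕ) → c ↭ oneTo t → c′ ↭ oneTo t →
    (pre : List ℕ) (rᵢ rᵢ₊₁ : ℕ) (post : List ℕ) →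
    canonical c ≡ pre ++ rᵢ ∷ rᵢ₊₁ ∷ post →
    canonical c′ ≡ pre ++ rᵢ₊₁ ∷ suc rᵢ ∷ post →
    rᵢ₊₁ < rᵢ →
    (k : ℕ) → (#vertices k (𝒢 c) ≡ #vertices k (𝒢 c′)) × (#edges k (𝒢 c) ≡ #edges k (𝒢 c′))
lemma6p5 t c c′ c↭ c′↭ pre rᵢ rᵢ₊₁ post eq eq′ descent k =
  sameVertices same (_≡ᵇ k) , sameEdges same (_≡ᵇ k)
  where
  same : 𝒢 c ≈ 𝒢 c′
  same = exchange-descent-≈ (reverse post) (reverse pre) c↭ c′↭
           (trans (cong reverse eq) (reverse-around-pair pre rᵢ rᵢ₊₁ post))
           (trans (cong reverse eq′) (reverse-around-pair pre rᵢ₊₁ (suc rᵢ) post))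
           descent
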